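{- Let $\phi:\Sigma^*\to\Gamma^*$ be an injective morphism and let $u,v\in\Sigma^*$. If $\phi$ is interference-free on $\{u\}$, then $\mathrm{occ}(u,v)=\mathrm{occ}(\phi(u),\phi(v))$.
   Context: $\mathrm{occ}(u,w)$ is the number of (possibly overlapping) occurrences of $u$ in $w$. Images of $\phi$ are $\phi(c)$, $c\in\Sigma$. $\phi$ is injective if $\phi(u)\neq\phi(v)$ for $u\ne v$. A word admits an image factorization if it is a concatenation of zero or more images. A word $w$ admits an interfered image factorization if $w=xyz$ with $x$ a proper (possibly empty) suffix of some image, $y$ admitting an image factorization, $z$ a proper (possibly empty) prefix of some image, and $xz\neq\varepsilon$. A word is an inner image factor if it is a proper factor of some image $\phi(c)$ that is neither a prefix nor a suffix of $\phi(c)$. For injective $\phi$, $\phi$ is interference-free on $\mathcal{L}$ if for every non-empty $u\in\mathcal{L}$, $\phi(u)$ admits no interfered image factorization and is not an inner image factor. -}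

module Defs where

open import Data.Nat using (ℕ; zero; suc; _+_)
open import Data.Fin using (Fin)
open import Data.Fin.Properties using (_≟_)
open import Data.List using (List; []; _∷_; _++_; concatMap)
open import Data.Product using (Σ; ∃; _×_)
open import Relation.Binary.PropositionalEquality using (_≡_; _≢_)
open import Relation.Nullary using (¬_; yes; no)

Morph : ℕ → ℕ → Set
Morph m k = Fin m → List (Fin k)

ext : ∀ {m k} → Morph m k → List (Fin m) → List (Fin k)
ext h = concatMap h

InjectiveMorph : ∀ {m k} → Morph m k → Set
InjectiveMorph h = ∀ u v → ext h u ≡ ext h v → u ≡ v

prefixCount : ∀ {k} → List (Fin k) → List (Fin k) → ℕ
prefixCount [] w = 1
prefixCount (a ∷ u) [] = 0
prefixCount (a ∷ u) (b ∷ w) with a ≟ b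
... | yes _ = prefixCount u w
... | no _ = 0

-- occ(u,w): number of (possibly overlapping) occurrences of u in w,
-- i.e. number of suffixes of w (including w and ε) having u as a prefix.
occ : ∀ {k} → List (Fin k) → List (Fin k) → ℕ
occ u [] = prefixCount u []
occ u (b ∷ w) = prefixCount u (b ∷ w) + occ u w

module _ {m k : ℕ} (h : Morph m k) where

  ImageFactorization : List (Fin k) → Set
  ImageFactorization w = ∃ λ (cs : List (Fin m)) → ext h cs ≡ w

  ProperSuffixOfImage : List (Fin k) → Set
  ProperSuffixOfImage x = ∃ λ (c : Fin m) → ∃ λ (p : List (Fin k)) → p ≢ [] × p ++ x ≡ h c

  ProperPrefixOfImage : List (Fin k) → Set
  ProperPrefixOfImage z = ∃ λ (c : Fin m) → ∃ λ (s : List (Fin k)) → s ≢ [] × z ++ s ≡ h c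

  InterferedImageFactorization : List (Fin k) → Set
  InterferedImageFactorization w =
    ∃ λ (x : List (Fin k)) → ∃ λ (y : List (Fin k)) → ∃ λ (z : List (Fin k)) →
      (w ≡ x ++ y ++ z) × ProperSuffixOfImage x × ImageFactorization y
      × ProperPrefixOfImage z × (x ++ z ≢ [])

  InnerImageFactor : List (Fin k) → Set
  InnerImageFactor w = ∃ λ (c : Fin m) →
      (∃ λ (p : List (Fin k)) → ∃ λ (s : List (Fin k)) → p ++ w ++ s ≡ h c)
    × (w ≢ h c)
    × ¬ (∃ λ (s : List (Fin k)) → w ++ s ≡ h c)
    × ¬ (∃ λ (p : List (Fin k)) → p ++ w ≡ h c)

  InterferenceFree : (List (Fin m) → Set) → Set
  InterferenceFree L = ∀ u → L u → u ≢ [] →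
    ¬ InterferedImageFactorization (ext h u) × ¬ InnerImageFactor (ext h u)

singleton : ∀ {m} → List (Fin m) → List (Fin m) → Set
singleton u u' = u' ≡ u

-- Since φ(u) has no interfered image factorization, an occurrence of φ(u) in
-- φ(v) can neither start strictly inside an image φ(b) (it would be an inner
-- image factor or would give an interfered factorization x y z with x ≠ ε) nor
-- start at the boundary of an image and end strictly inside one (interfered
-- factorization with z ≠ ε). So the occurrences of φ(u) in φ(v) are exactly the
-- images of occurrences of u in v, by injectivity.
module Submission where

open import Defs
open import Data.Nat using (ℕ; _+_; _≤_; s≤s)
open import Data.Nat.Properties using (m≤m+n; m≤n⇒m≤1+n; <⇒≢)
open import Data.Fin using (Fin)
open import Data.Fin.Properties using (_≟_)
open import Data.List using (List; []; _∷_; _++_; [_]; length)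
open import Data.List.Properties
  using (++-assoc; ++-identityʳ; ++-conicalˡ; ++-conicalʳ; ∷-injective; length-++; concatMap-++)
open import Data.Product using (∃; _×_; _,_; proj₁; proj₂)
open import Data.Sum using (_⊎_; inj₁; inj₂)
open import Data.Empty using (⊥-elim)
open import Function using (_∘_)
open import Function.Bundles using (_⇔_; mk⇔; Equivalence)
open import Relation.Nullary using (¬_; Dec; yes; no)
open import Relation.Binary.PropositionalEquality
  using (_≡_; _≢_; refl; sym; trans; cong; cong₂; subst; module ≡-Reasoning)

module _ {a} {A : Set a} where

  ++-equidivisible : (q r s t : List A) → q ++ r ≡ s ++ t →
    (∃ λ q′ → q ≡ s ++ q′ × q′ ++ r ≡ t) ⊎ (∃ λ s′ → s′ ≢ [] × s ≡ q ++ s′)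
  ++-equidivisible q       r []      t eq = inj₁ (q , refl , eq)
  ++-equidivisible []      r (x ∷ s) t eq = inj₂ (x ∷ s , (λ ()) , refl)
  ++-equidivisible (x ∷ q) r (y ∷ s) t eq with ∷-injective eq
  ... | refl , eq′ with ++-equidivisible q r s t eq′
  ...   | inj₁ (q′ , q≡s++q′ , eq″) = inj₁ (q′ , cong (x ∷_) q≡s++q′ , eq″)
  ...   | inj₂ (s′ , s′≢[] , s≡q++s′) = inj₂ (s′ , s′≢[] , cong (x ∷_) s≡q++s′)

  length-≤-infix : (p xs ys : List A) → length xs ≤ length (p ++ xs ++ ys)
  length-≤-infix []      xs ys = subst (length xs ≤_) (sym (length-++ xs)) (m≤m+n _ _)
  length-≤-infix (x ∷ p) xs ys = m≤n⇒m≤1+n (length-≤-infix p xs ys)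

  ≢-infix : ∀ {xs} (p ys : List A) → p ≢ [] → xs ≢ p ++ xs ++ ys
  ≢-infix []      ys p≢[] _  = p≢[] refl
  ≢-infix {xs} (x ∷ p) ys _ eq = <⇒≢ (s≤s (length-≤-infix p xs ys)) (cong length eq)

module _ {k : ℕ} where

  infix 4 _≼_ _≼?_

  _≼_ : List (Fin k) → List (Fin k) → Set
  u ≼ w = ∃ λ r → u ++ r ≡ w

  _≼?_ : (u w : List (Fin k)) → Dec (u ≼ w)
  []      ≼? w       = yes (w , refl)
  (a ∷ u) ≼? []      = no λ ()
  (a ∷ u) ≼? (b ∷ w) with a ≟ b | u ≼? w
  ... | no a≢b   | _        = no λ (_ , eq) → a≢b (proj₁ (∷-injective eq))
  ... | yes refl | yes (r , eq) = yes (r , cong (a ∷_) eq)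
  ... | yes refl | no u⋠w   = no λ (r , eq) → u⋠w (r , proj₂ (∷-injective eq))

  prefixCount-≼ : ∀ {u w} → u ≼ w → prefixCount u w ≡ 1
  prefixCount-≼ {[]}    _        = refl
  prefixCount-≼ {a ∷ u} (r , refl) with a ≟ a
  ... | yes _   = prefixCount-≼ {u} (r , refl)
  ... | no a≢a  = ⊥-elim (a≢a refl)

  prefixCount-⋠ : ∀ {u w} → ¬ u ≼ w → prefixCount u w ≡ 0
  prefixCount-⋠ {[]}    {w}     u⋠w = ⊥-elim (u⋠w (w , refl))
  prefixCount-⋠ {a ∷ u} {[]}    _   = refl
  prefixCount-⋠ {a ∷ u} {b ∷ w} u⋠w with a ≟ b
  ... | no _     = refl
  ... | yes refl = prefixCount-⋠ λ (r , eq) → u⋠w (r , cong (a ∷_) eq)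

prefixCount-cong : ∀ {k l} {u w : List (Fin k)} {u′ w′ : List (Fin l)} →
  u ≼ w ⇔ u′ ≼ w′ → prefixCount u w ≡ prefixCount u′ w′
prefixCount-cong {u = u} {w} u≼w⇔u′≼w′ with u ≼? w
... | yes u≼w = trans (prefixCount-≼ u≼w) (sym (prefixCount-≼ (Equivalence.to u≼w⇔u′≼w′ u≼w)))
... | no u⋠w  = trans (prefixCount-⋠ u⋠w) (sym (prefixCount-⋠ (u⋠w ∘ Equivalence.from u≼w⇔u′≼w′)))

module _ {m k : ℕ} (h : Morph m k) where

  ext-≼ : ∀ u v → u ≼ v → ext h u ≼ ext h v
  ext-≼ u v (r , refl) = ext h r , sym (concatMap-++ h u r)

  ext-≢[] : InjectiveMorph h → ∀ {u} → u ≢ [] → ext h u ≢ []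
  ext-≢[] inj {u} u≢[] eq = u≢[] (inj u [] eq)

  image-≢[] : InjectiveMorph h → ∀ c → h c ≢ []
  image-≢[] inj c = ext-≢[] inj {c ∷ []} (λ ()) ∘ trans (++-identityʳ (h c))

  []-properPrefix : ∀ {c} → h c ≢ [] → ProperPrefixOfImage h []
  []-properPrefix {c} hc≢[] = c , h c , hc≢[] , refl

  []-properSuffix : ∀ {c} → h c ≢ [] → ProperSuffixOfImage h []
  []-properSuffix {c} hc≢[] = c , h c , hc≢[] , ++-identityʳ (h c)

  prefix-of-ext : ∀ {q} w → q ≼ ext h w →
    ∃ λ cs → cs ≼ w × ∃ λ z → q ≡ ext h cs ++ z × (z ≡ [] ⊎ ProperPrefixOfImage h z)
  prefix-of-ext {q} [] (r , eq) = [] , ([] , refl) , [] , ++-conicalˡ q r eq , inj₁ refl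
  prefix-of-ext {q} (c ∷ w) (r , eq) with ++-equidivisible q r (h c) (ext h w) eq
  ... | inj₂ (s , s≢[] , hc≡q++s) =
    [] , (c ∷ w , refl) , q , refl , inj₂ (c , s , s≢[] , sym hc≡q++s)
  ... | inj₁ (q′ , q≡hc++q′ , eq′) with prefix-of-ext w (r , eq′)
  ...   | cs , (w′ , cs++w′≡w) , z , q′≡ , z-proper =
    c ∷ cs , (w′ , cong (c ∷_) cs++w′≡w) , z ,
    trans q≡hc++q′ (trans (cong (h c ++_) q′≡) (sym (++-assoc (h c) (ext h cs) z))) , z-proper

  ext-reflects-≼ : InjectiveMorph h → ∀ u v → ¬ InterferedImageFactorization h (ext h u) →
    ext h u ≼ ext h v → u ≼ v
  ext-reflects-≼ inj u v ¬interfered U≼V with prefix-of-ext v U≼V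
  ... | cs , cs≼v , [] , U≡ , _ = subst (_≼ v) (sym (inj u cs (trans U≡ (++-identityʳ _)))) cs≼v
  ... | cs , _ , a ∷ z , U≡ , inj₂ z-proper@(c , s , _ , a∷z++s≡hc) =
    ⊥-elim (¬interfered ([] , ext h cs , a ∷ z , U≡ , []-properSuffix ((λ ()) ∘ trans a∷z++s≡hc)
                        , (cs , refl) , z-proper , λ ()))

  module _ {U : List (Fin k)} (U≢[] : U ≢ [])
           (¬interfered : ¬ InterferedImageFactorization h U) where

    ¬properPrefix : ¬ ProperPrefixOfImage h U
    ¬properPrefix U-proper@(c , s , s≢[] , U++s≡hc) =
      ¬interfered ([] , [] , U , refl , []-properSuffix hc≢[] , ([] , refl) , U-proper , U≢[])
      where
      hc≢[] : h c ≢ []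
      hc≢[] = s≢[] ∘ ++-conicalʳ U s ∘ trans U++s≡hc

    ¬properSuffix : ¬ ProperSuffixOfImage h U
    ¬properSuffix U-proper@(c , p , p≢[] , p++U≡hc) =
      ¬interfered (U , [] , [] , sym (++-identityʳ U) , U-proper , ([] , refl) , []-properPrefix hc≢[]
                  , U≢[] ∘ trans (sym (++-identityʳ U)))
      where
      hc≢[] : h c ≢ []
      hc≢[] = p≢[] ∘ ++-conicalˡ p U ∘ trans p++U≡hc

    -- No hypothesis t ≢ [] is needed: U being a proper suffix (or prefix) of
    -- h b is already excluded by interference-freeness.
    inner-if-not-at-start : ∀ {b p t} → p ≢ [] → p ++ U ++ t ≡ h b → InnerImageFactor h U
    inner-if-not-at-start {b} {p} {t} p≢[] p++U++t≡hb =
      b , (p , t , p++U++t≡hb) , U≢hb , ¬prefix , ¬suffix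
      where
      U≢hb : U ≢ h b
      U≢hb U≡hb = ≢-infix p t p≢[] (trans U≡hb (sym p++U++t≡hb))
      ¬prefix : ¬ (∃ λ s → U ++ s ≡ h b)
      ¬prefix ([]    , eq) = U≢hb (trans (sym (++-identityʳ U)) eq)
      ¬prefix (x ∷ s , eq) = ¬properPrefix (b , x ∷ s , (λ ()) , eq)
      ¬suffix : ¬ (∃ λ p′ → p′ ++ U ≡ h b)
      ¬suffix ([]     , eq) = U≢hb eq
      ¬suffix (x ∷ p′ , eq) = ¬properSuffix (b , x ∷ p′ , (λ ()) , eq)

    module _ (¬inner : ¬ InnerImageFactor h U) where

      ⋠-inside-image : ∀ {b p s} v → p ≢ [] → s ≢ [] → p ++ s ≡ h b → ¬ U ≼ s ++ ext h v
      ⋠-inside-image {b} {p} {s} v p≢[] s≢[] p++s≡hb (r , eq)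
        with ++-equidivisible U r s (ext h v) eq
      ... | inj₂ (t , _ , s≡U++t) =
        ¬inner (inner-if-not-at-start p≢[] (trans (cong (p ++_) (sym s≡U++t)) p++s≡hb))
      ... | inj₁ (q , U≡s++q , q++r≡V) with prefix-of-ext v (r , q++r≡V)
      ...   | cs , _ , z , q≡ , z-proper =
        ¬interfered (s , ext h cs , z , trans U≡s++q (cong (s ++_) q≡) , (b , p , p≢[] , p++s≡hb)
                    , (cs , refl) , properPrefix z-proper , s≢[] ∘ ++-conicalˡ s z)
        where
        properPrefix : ∀ {z} → z ≡ [] ⊎ ProperPrefixOfImage h z → ProperPrefixOfImage h z
        properPrefix (inj₁ refl) = []-properPrefix (s≢[] ∘ ++-conicalʳ p s ∘ trans p++s≡hb)
        properPrefix (inj₂ z-proper) = z-proper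

      occ-proper-suffix : ∀ {b p s} v → p ≢ [] → p ++ s ≡ h b →
        occ U (s ++ ext h v) ≡ occ U (ext h v)
      occ-proper-suffix {s = []} _ _ _ = refl
      occ-proper-suffix {b} {p} {a ∷ s} v p≢[] p++s≡hb =
        cong₂ _+_ (prefixCount-⋠ (⋠-inside-image v p≢[] (λ ()) p++s≡hb))
                  (occ-proper-suffix v (p≢[] ∘ ++-conicalˡ p [ a ])
                                       (trans (++-assoc p [ a ] s) p++s≡hb))

      occ-image-++ : ∀ {b} v → h b ≢ [] →
        occ U (h b ++ ext h v) ≡ prefixCount U (h b ++ ext h v) + occ U (ext h v)
      occ-image-++ {b} v hb≢[] with h b in hb≡
      ... | []    = ⊥-elim (hb≢[] refl)
      ... | a ∷ s = cong (prefixCount U (a ∷ s ++ ext h v) +_)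
                         (occ-proper-suffix {p = [ a ]} v (λ ()) (sym hb≡))

proposition24 : (m k : ℕ) (h : Morph m k) → InjectiveMorph h →
    (u v : List (Fin m)) → u ≢ [] → InterferenceFree h (singleton u) →
    occ u v ≡ occ (ext h u) (ext h v)
proposition24 m k h inj u v u≢[] free = occ-ext v
  where
  open ≡-Reasoning

  U : List (Fin k)
  U = ext h u

  ¬interfered : ¬ InterferedImageFactorization h U
  ¬interfered = proj₁ (free u refl u≢[])

  ¬inner : ¬ InnerImageFactor h U
  ¬inner = proj₂ (free u refl u≢[])

  prefixCount-ext : ∀ v → prefixCount u v ≡ prefixCount U (ext h v)
  prefixCount-ext v = prefixCount-cong (mk⇔ (ext-≼ h u v) (ext-reflects-≼ h inj u v ¬interfered))

  occ-ext : ∀ v → occ u v ≡ occ U (ext h v)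
  occ-ext []      = prefixCount-ext []
  occ-ext (b ∷ v) = begin
    prefixCount u (b ∷ v) + occ u v
      ≡⟨ cong₂ _+_ (prefixCount-ext (b ∷ v)) (occ-ext v) ⟩
    prefixCount U (h b ++ ext h v) + occ U (ext h v)
      ≡⟨ occ-image-++ h (ext-≢[] h inj u≢[]) ¬interfered ¬inner v (image-≢[] h inj b) ⟨
    occ U (h b ++ ext h v)
      ∎
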